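{- Let $M$ be an ordered model, let $\varphi\in\mathcal{L}$, and let $M'$ be the subsequence of $M$ consisting of precisely those atoms of $M$ that occur in $\varphi$ (in the same order as in $M$). Then $M\models\varphi$ if and only if $M'\models\varphi$.
   Context: Let $\mathcal{U}$ be a countable set of goal atoms. The language $\mathcal{L}$ over $\mathcal{U}$ is the smallest set containing every $a\in\mathcal{U}$ and closed under: if $\varphi,\psi\in\mathcal{L}$ then $(\neg\varphi),(\varphi\land\psi),(\square\varphi)\in\mathcal{L}$. An ordered model is a finite sequence of atoms from $\mathcal{U}$ without repetition. $P$ is a prefix of $Q$ iff $Q=PR$ for some possibly empty sequence $R$ (so every sequence is a prefix of itself and the empty sequence is a prefix of every sequence). Truth: $M\models a$ iff $a$ occurs in $M$ (for $a\in\mathcal{U}$); $M\models\neg\psi$ iff $M\not\models\psi$; $M\models\psi\land\varphi$ iff $M\models\psi$ and $M\models\varphi$; $M\models\square\varphi$ iff $M''\models\varphi$ for every prefix $M''$ of $M$. -}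

module Defs where

open import Data.List using (List; []; _∷_; _++_; filter)
open import Data.List.Membership.DecPropositional using ()
open import Data.List.Membership.Propositional using (_∈_)
open import Data.List.Relation.Unary.Unique.Propositional using (Unique)
open import Data.List.Relation.Unary.Any using (any?)
open import Data.Product using (Σ; _×_)
open import Relation.Binary.Definitions using (DecidableEquality)
open import Relation.Binary.PropositionalEquality using (_≡_)
open import Relation.Nullary using (¬_)

module _ {A : Set} where

  data Form : Set where
    atom : A → Form
    ¬'_  : Form → Form
    _∧'_ : Form → Form → Form
    □_   : Form → Form

  _IsPrefixOf_ : List A → List A → Set
  P IsPrefixOf Q = Σ (List A) (λ R → Q ≡ P ++ R)

  record OrderedModel : Set where
    constructor model
    field
      seq    : List A
      unique : Unique seq

  _⊨_ : List A → Form → Set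
  M ⊨ atom a   = a ∈ M
  M ⊨ (¬' φ)   = ¬ (M ⊨ φ)
  M ⊨ (φ ∧' ψ) = (M ⊨ φ) × (M ⊨ ψ)
  M ⊨ (□ φ)    = (M'' : List A) → M'' IsPrefixOf M → M'' ⊨ φ

  atoms : Form → List A
  atoms (atom a)  = a ∷ []
  atoms (¬' φ)    = atoms φ
  atoms (φ ∧' ψ)  = atoms φ ++ atoms ψ
  atoms (□ φ)     = atoms φ

  restrict : DecidableEquality A → Form → List A → List A
  restrict _≟_ φ M = filter (λ a → any? (_≟_ a) (atoms φ)) M

{-# OPTIONS --safe #-}
module Submission where

open import Defs
open import Data.List.Relation.Unary.Unique.Propositional using (Unique)
open import Data.List using (List; []; _∷_; _++_; filter)
open import Data.List.Properties using (filter-++; filter-accept; filter-reject; ∷-injective)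
open import Data.List.Membership.Propositional.Properties using (∈-filter⁺; ∈-filter⁻)
open import Data.List.Relation.Unary.All using (All; []; _∷_; tabulate)
open import Data.List.Relation.Unary.All.Properties using (++⁻ˡ; ++⁻ʳ)
open import Data.List.Relation.Unary.Any using (any?)
open import Data.Nat using (ℕ)
open import Data.Nat.Properties using (_≟_)
open import Data.Product using (Σ-syntax; ∃₂; _×_; _,_; proj₁)
open import Data.Product.Function.NonDependent.Propositional using (_×-⇔_)
open import Function.Base using (id)
open import Function.Bundles using (_⇔_; mk⇔; Equivalence)
open import Function.Related.TypeIsomorphisms using (¬-cong-⇔)
open import Relation.Binary.PropositionalEquality using (_≡_; refl; cong; trans)
open import Relation.Nullary using (yes; no)
open import Relation.Unary using (Pred; Decidable)

-- Filtering preserves truth because the formula only inspects atoms satisfying P, and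
-- the prefixes of filter P M are exactly the filtered prefixes of M.

module _ {A : Set} {p} {P : Pred A p} (P? : Decidable P) where

  filter-≡-++⁻ : ∀ M N R → filter P? M ≡ N ++ R →
                 ∃₂ λ M₁ M₂ → M ≡ M₁ ++ M₂ × filter P? M₁ ≡ N × filter P? M₂ ≡ R
  filter-≡-++⁻ M       []      R eq = [] , M , refl , refl , eq
  filter-≡-++⁻ []      (_ ∷ _) R ()
  filter-≡-++⁻ (x ∷ M) (y ∷ N) R eq with P? x
  ... | no ¬Px with filter-≡-++⁻ M (y ∷ N) R eq
  ...   | M₁ , M₂ , refl , filter-M₁ , filter-M₂ =
    x ∷ M₁ , M₂ , refl , trans (filter-reject P? ¬Px) filter-M₁ , filter-M₂
  filter-≡-++⁻ (x ∷ M) (y ∷ N) R eq | yes Px with ∷-injective eq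
  ... | refl , eq′ with filter-≡-++⁻ M N R eq′
  ...   | M₁ , M₂ , refl , filter-M₁ , filter-M₂ =
    x ∷ M₁ , M₂ , refl , trans (filter-accept P? Px) (cong (x ∷_) filter-M₁) , filter-M₂

  filter-prefix⁺ : ∀ {N M} → N IsPrefixOf M → filter P? N IsPrefixOf filter P? M
  filter-prefix⁺ {N} (R , refl) = filter P? R , filter-++ P? N R

  filter-prefix⁻ : ∀ {N M} → N IsPrefixOf filter P? M →
                   Σ[ M″ ∈ List A ] M″ IsPrefixOf M × filter P? M″ ≡ N
  filter-prefix⁻ {N} {M} (R , eq) with filter-≡-++⁻ M N R eq
  ... | M₁ , M₂ , refl , filter-M₁ , _ = M₁ , (M₂ , refl) , filter-M₁

  ⊨-filter : ∀ (φ : Form) → All P (atoms φ) → (M : List A) → (M ⊨ φ) ⇔ (filter P? M ⊨ φ)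
  ⊨-filter (atom a) (Pa ∷ []) M = mk⇔ (λ a∈M → ∈-filter⁺ P? a∈M Pa) (λ a∈M′ → proj₁ (∈-filter⁻ P? a∈M′))
  ⊨-filter (¬' φ)   Pφ M = ¬-cong-⇔ (⊨-filter φ Pφ M)
  ⊨-filter (φ ∧' ψ) Pφψ M =
    ⊨-filter φ (++⁻ˡ (atoms φ) Pφψ) M ×-⇔ ⊨-filter ψ (++⁻ʳ (atoms φ) Pφψ) M
  ⊨-filter (□ φ)    Pφ M = mk⇔ to from
    where
    to : M ⊨ (□ φ) → filter P? M ⊨ (□ φ)
    to □φ N N≤M′ with filter-prefix⁻ N≤M′
    ... | M″ , M″≤M , refl = Equivalence.to (⊨-filter φ Pφ M″) (□φ M″ M″≤M)

    from : filter P? M ⊨ (□ φ) → M ⊨ (□ φ)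
    from □φ M″ M″≤M = Equivalence.from (⊨-filter φ Pφ M″) (□φ (filter P? M″) (filter-prefix⁺ M″≤M))

theorem3 : (M : List ℕ) → Unique M → (φ : Form {ℕ}) →
    (M ⊨ φ) ⇔ (restrict _≟_ φ M ⊨ φ)
theorem3 M _ φ = ⊨-filter (λ a → any? (a ≟_) (atoms φ)) φ (tabulate id) M
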